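{- Let $m\ge 1$ and let $A_m$ be the set of integer tuples $\alpha=(\alpha_m,\dots,\alpha_1)$ with $0\le\alpha_j\le j-1$ for all $j\in[m]$. For $\alpha\in A_m$ let $P_1(\alpha)\subseteq[m]$ be the set of positions belonging to the component $Z_1(\alpha)$ (defined in the context), let $N(\alpha)=[m]\setminus P_1(\alpha)$, and let $Z(\alpha)$ denote the restriction of $\alpha$ to the positions in $N(\alpha)$ (i.e. the set of positions $N(\alpha)$ together with the values $\alpha_j$, $j\in N(\alpha)$); equivalently $Z(\alpha)$ is the union of all components of $\alpha$ other than $Z_1(\alpha)$. Write $z=|N(\alpha)|$. Then: (a) for each $z$ with $0\le z\le m-1$, the number of distinct restrictions $Z(\alpha)$ with $|N(\alpha)|=z$, as $\alpha$ ranges over $A_m$, equals $\binom{m-1}{z}\,z!$; (b) for each fixed such restriction $Z$ with $|N|=z$, the number of $\alpha\in A_m$ with $Z(\alpha)=Z$ equals $(m-1-z)!$.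
   Context: Covering and components: for $\alpha\in A_m$ and a position $i\in[m]$ with $\alpha_i>0$, the index $\alpha_i$ "covers" the index $\alpha_{\alpha_i}$; write $\kappa(i)=\alpha_i$ (a position strictly smaller than $i$). Positions $i$ with $\alpha_i=0$ cover nothing, and iterating $\kappa$ from any position eventually reaches a position $h$ with $\alpha_h=0$. For each $h$ with $\alpha_h=0$, the component $Z_h(\alpha)$ is the set of indices $\alpha_j$ (positions $j$ together with their values) such that $\kappa^k(j)=h$ for some $k\ge 0$. The components partition the indices of $\alpha$; since $\alpha_1=0$ always, $Z_1(\alpha)$ is nonempty and contains position $1$. A component is regarded not merely as a set of positions but as those positions with their assigned values. -}

module Defs where

open import Data.Nat using (ℕ; zero; suc; _≟_)
open import Data.Fin using (Fin; toℕ)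
open import Data.Unit using (⊤)
open import Data.Product using (Σ; _×_; _,_)
open import Data.Maybe using (Maybe; just; nothing)
open import Data.List using (List; length; filter; map; upTo)
open import Data.List.Membership.Propositional using (_∈_)
open import Data.List.Relation.Unary.Unique.Propositional using (Unique)
open import Data.Vec using (Vec; tabulate)
open import Relation.Nullary using (yes; no; ¬?)
open import Relation.Binary.PropositionalEquality using (_≡_)

-- A m : tuples (α_m, …, α_1) with 0 ≤ α_j ≤ j-1.
-- An element of A (suc m) is a pair (α' , a) with α' ∈ A m giving
-- (α_m,…,α_1) and a ∈ Fin (suc m) giving α_{m+1} ∈ {0,…,m}.
A : ℕ → Set
A zero    = ⊤
A (suc m) = A m × Fin (suc m)

-- get α j = α_j for a position j ∈ [m] (1-indexed); 0 outside [m].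
get : ∀ {m} → A m → ℕ → ℕ
get {zero}  _ j = 0
get {suc m} (α , a) j with j ≟ suc m
... | yes _ = toℕ a
... | no  _ = get α j

-- follow n f j : starting at position j, repeatedly apply the covering
-- map κ(i) = f i while f i > 0, at most n times; returns the position reached.
follow : ℕ → (ℕ → ℕ) → ℕ → ℕ
follow zero    f j = j
follow (suc n) f j with f j
... | zero  = j
... | suc k = follow n f (suc k)

-- root α j : the position h with α_h = 0 reached by iterating κ from j,
-- i.e. the h with j ∈ Z_h(α).  Since κ strictly decreases positions,
-- j steps of fuel always suffice for j ∈ [m].
root : ∀ {m} → A m → ℕ → ℕ
root α j = follow j (get α) j

positions : ℕ → List ℕ
positions m = map suc (upTo m)

-- N(α) = [m] ∖ P₁(α), where P₁(α) = { j ∈ [m] | root α j = 1 }.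
N : ∀ {m} → A m → List ℕ
N {m} α = filter (λ j → ¬? (root α j ≟ 1)) (positions m)

sizeN : ∀ {m} → A m → ℕ
sizeN α = length (N α)

-- A restriction of a tuple in A m to a subset of positions: entry at index i
-- (position toℕ i + 1) is nothing if the position is not in the subset and
-- just v if it is in the subset with assigned value v.
Restr : ℕ → Set
Restr m = Vec (Maybe ℕ) m

Z : ∀ {m} → A m → Restr m
Z {m} α = tabulate λ (i : Fin m) → entry (suc (toℕ i))
  where
  entry : ℕ → Maybe ℕ
  entry j with root α j ≟ 1
  ... | yes _ = nothing
  ... | no  _ = just (get α j)

HasCard : (X : Set) → (X → Set) → ℕ → Set
HasCard X P n =
  Σ (List X) λ L → Unique L × ((x : X) → (x ∈ L → P x) × (P x → x ∈ L)) × length L ≡ n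

-- Appending a value a ∈ {0,…,m} to α ∈ A_m changes Z only by one new last entry, and that
-- entry depends on Z(α) and a alone: the new position joins the component of position a (a new
-- component if a = 0), so it lies in P₁, i.e. is a hole of the restriction, exactly when position a
-- does.  Hence the restrictions with z filled entries at length m + 1 are those of length m with z
-- filled entries followed by a hole, together with those with z − 1 filled entries followed by one
-- of the z values a outside P₁; Pascal's rule turns this into C(m, z) z!.  Over a fixed restriction
-- R, each step multiplies the number of tuples by the number of values a producing the same new
-- entry: |P₁| when it is a hole and 1 otherwise, which telescopes to (|P₁(R)| − 1)! = (m − 1 − z)!.

module Submission where

open import Defs
open import Data.Nat using (ℕ; zero; suc; pred; _+_; _*_; _∸_; _≤_; _<_; z≤n; s≤s; _≟_; _!)
open import Data.Nat.Properties
  using (≤-refl; ≤-trans; <⇒≤; ≤-pred; <-irrefl; n≤0⇒n≡0; +-comm; +-suc; *-comm; *-assoc;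
         *-identityʳ; *-distribʳ-+; m+n∸m≡n; pred[m∸n]≡m∸[1+n])
open import Data.Nat.Combinatorics using (_C_; nCk+nC[k+1]≡[n+1]C[k+1])
open import Data.Bool using (true; false; T)
open import Data.Fin using (Fin; zero; suc; toℕ; inject₁; fromℕ)
open import Data.Fin.Properties
  using (toℕ-injective; toℕ-inject₁; toℕ-fromℕ; toℕ<n; toℕ≤pred[n]; suc-injective)
open import Data.Maybe using (Maybe; just; nothing; is-just; is-nothing)
import Data.Maybe as Maybe
open import Data.Maybe.Properties using (just-injective)
open import Data.Product using (Σ; _×_; _,_; proj₁; proj₂)
open import Data.Sum using (_⊎_; inj₁; inj₂)
open import Data.Empty using (⊥-elim)
open import Data.Unit using (tt)
open import Data.List as List using (List; []; _∷_; _++_; length; filter; applyUpTo)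
open import Data.List.Properties using (length-map; length-++; map-upTo)
open import Data.List.Membership.Propositional using (_∈_)
open import Data.List.Membership.Propositional.Properties
  using (∈-map⁺; ∈-map⁻; ∈-++⁺ˡ; ∈-++⁺ʳ; ∈-++⁻)
open import Data.List.Relation.Unary.Any using (here; there)
import Data.List.Relation.Unary.All as All
open import Data.List.Relation.Unary.AllPairs using ([]; _∷_)
open import Data.List.Relation.Unary.Unique.Propositional using (Unique)
import Data.List.Relation.Unary.Unique.Propositional.Properties as Unique
open import Data.Vec using (Vec; []; _∷_; _∷ʳ_; lookup; tabulate; count; countᵇ)
open import Data.Vec.Properties
  using (lookup∘tabulate; tabulate∘lookup; tabulate-cong; ∷ʳ-injective; ∷ʳ-injectiveˡ; ∷ʳ-injectiveʳ)
open import Function using (_∘_; _∋_; const)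
open import Function.Definitions using (Injective)
open import Relation.Nullary using (¬_; yes; no; does; ¬?; contradiction)
open import Relation.Nullary.Decidable using (T?)
open import Relation.Unary using (Decidable)
open import Relation.Binary.PropositionalEquality
  using (_≡_; refl; sym; trans; cong; cong₂; subst; module ≡-Reasoning)

open ≡-Reasoning

-- Counting finite sets

module _ {X : Set} where

  HasCard-resp : ∀ {P Q : X → Set} {n} →
                 (∀ x → P x → Q x) → (∀ x → Q x → P x) → HasCard X P n → HasCard X Q n
  HasCard-resp P⇒Q Q⇒P (L , unique , complete , len) =
    L , unique , (λ x → P⇒Q x ∘ proj₁ (complete x) , proj₂ (complete x) ∘ Q⇒P x) , len

  HasCard-empty : ∀ {P : X → Set} → (∀ x → ¬ P x) → HasCard X P 0
  HasCard-empty ¬P = [] , [] , (λ x → (λ ()) , ⊥-elim ∘ ¬P x) , refl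

  HasCard-singleton : (x₀ : X) → HasCard X (_≡ x₀) 1
  HasCard-singleton x₀ =
    x₀ ∷ [] , All.[] ∷ [] , (λ x → (λ { (here x≡x₀) → x≡x₀ }) , here) , refl

  HasCard-⊎ : ∀ {P Q : X → Set} {n k} → (∀ x → P x → ¬ Q x) →
              HasCard X P n → HasCard X Q k → HasCard X (λ x → P x ⊎ Q x) (n + k)
  HasCard-⊎ {P} {Q} P⇒¬Q (L₁ , u₁ , c₁ , refl) (L₂ , u₂ , c₂ , refl) =
    L₁ ++ L₂ ,
    Unique.++⁺ u₁ u₂ (λ (x∈L₁ , x∈L₂) → P⇒¬Q _ (proj₁ (c₁ _) x∈L₁) (proj₁ (c₂ _) x∈L₂)) ,
    (λ x → sound x ∘ ∈-++⁻ L₁ , complete x) ,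
    length-++ L₁
    where
    sound : ∀ x → x ∈ L₁ ⊎ x ∈ L₂ → P x ⊎ Q x
    sound x (inj₁ x∈L₁) = inj₁ (proj₁ (c₁ x) x∈L₁)
    sound x (inj₂ x∈L₂) = inj₂ (proj₁ (c₂ x) x∈L₂)
    complete : ∀ x → P x ⊎ Q x → x ∈ L₁ ++ L₂
    complete x (inj₁ Px) = ∈-++⁺ˡ (proj₂ (c₁ x) Px)
    complete x (inj₂ Qx) = ∈-++⁺ʳ L₁ (proj₂ (c₂ x) Qx)

HasCard-image : ∀ {X Y : Set} {P : X → Set} {n} (f : X → Y) → Injective _≡_ _≡_ f →
                HasCard X P n → HasCard Y (λ y → Σ X λ x → P x × f x ≡ y) n
HasCard-image f f-injective (L , unique , complete , len) =
  List.map f L ,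
  Unique.map⁺ f-injective unique ,
  (λ y → sound y , λ { (x , Px , refl) → ∈-map⁺ f (proj₂ (complete x) Px) }) ,
  trans (length-map f L) len
  where
  sound : ∀ y → y ∈ List.map f L → _
  sound y y∈ with ∈-map⁻ f y∈
  ... | x , x∈L , refl = x , proj₁ (complete x) x∈L , refl

HasCard-Σ : ∀ {X Y : Set} {P : X → Set} {Q : X → Y → Set} {n k} →
            (∀ x → P x → HasCard Y (Q x) k) → HasCard X P n →
            HasCard (X × Y) (λ p → P (proj₁ p) × Q (proj₁ p) (proj₂ p)) (n * k)
HasCard-Σ {X} {Y} {Q = Q} {k = k} fibre (L , unique , complete , refl) =
  HasCard-resp (λ _ (x∈L , Qxy) → proj₁ (complete _) x∈L , Qxy)
               (λ _ (Px , Qxy) → proj₂ (complete _) Px , Qxy)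
               (pairs L unique λ x → fibre x ∘ proj₁ (complete x))
  where
  pairs : (L : List X) → Unique L → (∀ x → x ∈ L → HasCard Y (Q x) k) →
          HasCard (X × Y) (λ p → proj₁ p ∈ L × Q (proj₁ p) (proj₂ p)) (length L * k)
  pairs [] _ _ = HasCard-empty λ _ ()
  pairs (x ∷ L) (x∉L ∷ unique) fibres =
    HasCard-resp (λ { _ (inj₁ (y , Qxy , refl)) → here refl , Qxy
                    ; _ (inj₂ (x′∈L , Qx′y)) → there x′∈L , Qx′y })
                 (λ { _ (here refl , Qxy) → inj₁ (_ , Qxy , refl)
                    ; _ (there x′∈L , Qx′y) → inj₂ (x′∈L , Qx′y) })
                 (HasCard-⊎ (λ { _ (_ , _ , refl) (x∈L , _) → All.lookup x∉L x∈L refl })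
                            (HasCard-image (x ,_) (λ { refl → refl }) (fibres x (here refl)))
                            (pairs L unique (λ x′ → fibres x′ ∘ there)))

module _ {m : ℕ} {P : Fin (suc m) → Set} {k : ℕ} (tail : HasCard (Fin m) (P ∘ suc) k) where

  HasCard-Fin-zero∈ : P zero → HasCard (Fin (suc m)) P (suc k)
  HasCard-Fin-zero∈ P0 =
    HasCard-resp (λ { _ (inj₁ refl) → P0 ; _ (inj₂ (_ , Pi , refl)) → Pi })
                 (λ { zero _ → inj₁ refl ; (suc i) Pi → inj₂ (i , Pi , refl) })
                 (HasCard-⊎ (λ { _ refl (_ , _ , ()) })
                            (HasCard-singleton zero)
                            (HasCard-image suc suc-injective tail))

  HasCard-Fin-zero∉ : ¬ P zero → HasCard (Fin (suc m)) P k
  HasCard-Fin-zero∉ ¬P0 =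
    HasCard-resp (λ { _ (_ , Pi , refl) → Pi })
                 (λ { zero P0 → contradiction P0 ¬P0 ; (suc i) Pi → i , Pi , refl })
                 (HasCard-image suc suc-injective tail)

HasCard-lookup : ∀ {X : Set} {P : X → Set} (P? : Decidable P) {m} (v : Vec X m) →
                 HasCard (Fin m) (P ∘ lookup v) (count P? v)
HasCard-lookup P? []      = HasCard-empty λ ()
HasCard-lookup P? (x ∷ v) with P? x
... | yes Px = HasCard-Fin-zero∈ (HasCard-lookup P? v) Px
... | no ¬Px = HasCard-Fin-zero∉ (HasCard-lookup P? v) ¬Px

tabulate-∷ʳ : ∀ {X : Set} {n} (f : Fin (suc n) → X) →
              tabulate f ≡ tabulate (f ∘ inject₁) ∷ʳ f (fromℕ n)
tabulate-∷ʳ {n = zero}  f = refl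
tabulate-∷ʳ {n = suc n} f = cong (f zero ∷_) (tabulate-∷ʳ (f ∘ suc))

count-∷ʳ : ∀ {X : Set} {P : X → Set} (P? : Decidable P) {n} (xs : Vec X n) x →
           count P? (xs ∷ʳ x) ≡ count P? (x ∷ xs)
count-∷ʳ P? []       x = refl
count-∷ʳ P? (y ∷ xs) x rewrite count-∷ʳ P? xs x with does (P? x) | does (P? y)
... | true  | true  = refl
... | true  | false = refl
... | false | true  = refl
... | false | false = refl

count-tabulate≡length-filter :
  ∀ {X Y : Set} {P : X → Set} {Q : Y → Set} (P? : Decidable P) (Q? : Decidable Q)
  (f : ℕ → X) (g : ℕ → Y) → (∀ j → does (P? (f j)) ≡ does (Q? (g j))) →
  ∀ m → count P? (tabulate {n = m} (f ∘ toℕ)) ≡ length (filter Q? (applyUpTo g m))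
count-tabulate≡length-filter P? Q? f g same zero = refl
count-tabulate≡length-filter P? Q? f g same (suc m) with does (P? (f 0)) | does (Q? (g 0)) | same 0
... | true  | true  | _ = cong suc (count-tabulate≡length-filter P? Q? (f ∘ suc) (g ∘ suc) (same ∘ suc) m)
... | false | false | _ = count-tabulate≡length-filter P? Q? (f ∘ suc) (g ∘ suc) (same ∘ suc) m

is-just-map : ∀ {X Y : Set} (f : X → Y) x → is-just (Maybe.map f x) ≡ is-just x
is-just-map f (just _) = refl
is-just-map f nothing  = refl

map≡nothing : ∀ {X Y : Set} (f : X → Y) x → T (is-nothing x) → Maybe.map f x ≡ nothing
map≡nothing f nothing _ = refl

map≡nothing⁻ : ∀ {X Y : Set} (f : X → Y) x → Maybe.map f x ≡ nothing → T (is-nothing x)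
map≡nothing⁻ f nothing _ = tt

-- The covering map and roots

Descending : (ℕ → ℕ) → Set
Descending f = ∀ j → f j ≤ pred j

covers-below : ∀ {f} → Descending f → ∀ {j k} → f j ≡ suc k → suc k < j
covers-below desc {zero}  fj≡ with () ← subst (_≤ 0) fj≡ (desc zero)
covers-below desc {suc j} fj≡ = s≤s (subst (_≤ j) fj≡ (desc (suc j)))

get-descending : ∀ {m} (α : A m) → Descending (get α)
get-descending {zero}  α       j = z≤n
get-descending {suc m} (α , a) j with j ≟ suc m
... | yes refl = toℕ≤pred[n] a
... | no  _    = get-descending α j

get-old : ∀ {m} (α : A m) a {j} → j ≤ m → get (α , a) j ≡ get α j
get-old {m} α a {j} j≤m with j ≟ suc m
... | yes refl = contradiction j≤m (<-irrefl refl)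
... | no  _    = refl

get-new : ∀ {m} (α : A m) a → get (α , a) (suc m) ≡ toℕ a
get-new {m} α a with suc m ≟ suc m
... | yes _  = refl
... | no  m≢m = contradiction refl m≢m

follow-stop : ∀ {n} f {j} → f j ≡ 0 → follow (suc n) f j ≡ j
follow-stop f fj≡0 rewrite fj≡0 = refl

follow-step : ∀ {n} f {j k} → f j ≡ suc k → follow (suc n) f j ≡ follow n f (suc k)
follow-step f fj≡ rewrite fj≡ = refl

follow-cong : ∀ n {f g} → Descending f → ∀ {j} → (∀ {i} → i ≤ j → f i ≡ g i) →
              follow n f j ≡ follow n g j
follow-cong zero    desc agree = refl
follow-cong (suc n) {f} {g} desc {j} agree with f j in fj
... | zero  = sym (follow-stop g (trans (sym (agree ≤-refl)) fj))
... | suc k = trans (follow-cong n desc (agree ∘ below))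
                    (sym (follow-step g (trans (sym (agree ≤-refl)) fj)))
  where
  below : ∀ {i} → i ≤ suc k → i ≤ j
  below i≤ = ≤-trans i≤ (<⇒≤ (covers-below desc fj))

follow-fuel : ∀ n n′ {f} → Descending f → ∀ {j} → j ≤ n → j ≤ n′ →
              follow n f j ≡ follow n′ f j
follow-fuel zero    zero     desc _   _    = refl
follow-fuel zero    (suc n′) {f} desc z≤n _    = sym (follow-stop f (n≤0⇒n≡0 (desc 0)))
follow-fuel (suc n) zero     {f} desc _   z≤n  = follow-stop f (n≤0⇒n≡0 (desc 0))
follow-fuel (suc n) (suc n′) {f} desc {j} j≤n j≤n′ with f j in fj
... | zero  = refl
... | suc k = follow-fuel n n′ desc (lower j≤n) (lower j≤n′)
  where
  lower : ∀ {N} → j ≤ suc N → suc k ≤ N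
  lower j≤ = ≤-pred (≤-trans (covers-below desc fj) j≤)

root-old : ∀ {m} (α : A m) a {j} → j ≤ m → root (α , a) j ≡ root α j
root-old α a {j} j≤m =
  follow-cong j (get-descending (α , a)) (λ i≤j → get-old α a (≤-trans i≤j j≤m))

root-new-zero : ∀ {m} (α : A m) → root (α , zero) (suc m) ≡ suc m
root-new-zero α = follow-stop (get (α , zero)) (get-new α zero)

root-new-suc : ∀ {m} (α : A m) (i : Fin m) → root (α , suc i) (suc m) ≡ root α (suc (toℕ i))
root-new-suc {m} α i = begin
  root (α , suc i) (suc m)                    ≡⟨ follow-step {m} (get (α , suc i)) {suc m}
                                                   (get-new α (suc i)) ⟩
  follow m (get (α , suc i)) (suc (toℕ i))    ≡⟨ follow-cong m (get-descending (α , suc i))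
                                                   (λ i′≤ → get-old α (suc i) (≤-trans i′≤ (toℕ<n i))) ⟩
  follow m (get α) (suc (toℕ i))              ≡⟨ follow-fuel m (suc (toℕ i)) (get-descending α)
                                                   (toℕ<n i) ≤-refl ⟩
  root α (suc (toℕ i))                        ∎

root-one : ∀ {m} (α : A m) → root α 1 ≡ 1
root-one α = follow-stop (get α) (n≤0⇒n≡0 (get-descending α 1))

restrictEntry : (root value : ℕ) → Maybe ℕ
restrictEntry r v with r ≟ 1
... | yes _ = nothing
... | no  _ = just v

entry : ∀ {m} → A m → ℕ → Maybe ℕ
entry α j = restrictEntry (root α j) (get α j)

-- The entry function of Z is local to Defs; the ascription lets unification supply it,
-- and the with-abstraction then exposes the same decision on both sides.
lookup-Z : ∀ {m} (α : A m) i → lookup (Z α) i ≡ entry α (suc (toℕ i))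
lookup-Z α i with root α (suc (toℕ i)) ≟ 1 | (lookup (Z α) i ≡ _ ∋ lookup∘tabulate _ i)
... | yes _ | lookup-Z≡ = lookup-Z≡
... | no  _ | lookup-Z≡ = lookup-Z≡

entry-old : ∀ {m} (α : A m) a {j} → j ≤ m → entry (α , a) j ≡ entry α j
entry-old α a j≤m = cong₂ restrictEntry (root-old α a j≤m) (get-old α a j≤m)

-- A new last position with value a joins the component of position a (a new one if a = 0),
-- so it is a hole of Z exactly when position a is.
newEntry : ∀ {m} → Restr m → Fin (suc m) → Maybe ℕ
newEntry R zero    = just 0
newEntry R (suc i) = Maybe.map (const (suc (toℕ i))) (lookup R i)

map-const-restrictEntry : ∀ r v w → Maybe.map (const w) (restrictEntry r v) ≡ restrictEntry r w
map-const-restrictEntry zero          v w = refl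
map-const-restrictEntry (suc zero)    v w = refl
map-const-restrictEntry (suc (suc r)) v w = refl

entry-new : ∀ {n} (α : A (suc n)) a → entry (α , a) (suc (suc n)) ≡ newEntry (Z α) a
entry-new α zero    = cong₂ restrictEntry (root-new-zero α) (get-new α zero)
entry-new {n} α (suc i) = begin
  entry (α , suc i) (suc (suc n))           ≡⟨ cong₂ restrictEntry (root-new-suc α i) (get-new α (suc i)) ⟩
  restrictEntry (root α j) j                ≡⟨ map-const-restrictEntry (root α j) (get α j) j ⟨
  Maybe.map (const j) (entry α j)           ≡⟨ cong (Maybe.map (const j)) (lookup-Z α i) ⟨
  newEntry (Z α) (suc i)                    ∎
  where j = suc (toℕ i)

Z-extend : ∀ {n} (α : A (suc n)) a → Z (α , a) ≡ Z α ∷ʳ newEntry (Z α) a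
Z-extend {n} α a = begin
  Z (α , a)                                                 ≡⟨ tabulate∘lookup (Z (α , a)) ⟨
  tabulate (lookup (Z (α , a)))                             ≡⟨ tabulate-∷ʳ (lookup (Z (α , a))) ⟩
  tabulate (lookup (Z (α , a)) ∘ inject₁) ∷ʳ lookup (Z (α , a)) (fromℕ _)
                                                            ≡⟨ cong₂ _∷ʳ_ (tabulate-cong old) new ⟩
  tabulate (lookup (Z α)) ∷ʳ newEntry (Z α) a               ≡⟨ cong (_∷ʳ newEntry (Z α) a)
                                                                    (tabulate∘lookup (Z α)) ⟩
  Z α ∷ʳ newEntry (Z α) a                                   ∎
  where
  old : ∀ i → lookup (Z (α , a)) (inject₁ i) ≡ lookup (Z α) i
  old i = begin
    lookup (Z (α , a)) (inject₁ i)            ≡⟨ lookup-Z (α , a) (inject₁ i) ⟩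
    entry (α , a) (suc (toℕ (inject₁ i)))     ≡⟨ cong (entry (α , a) ∘ suc) (toℕ-inject₁ i) ⟩
    entry (α , a) (suc (toℕ i))               ≡⟨ entry-old α a (toℕ<n i) ⟩
    entry α (suc (toℕ i))                     ≡⟨ lookup-Z α i ⟨
    lookup (Z α) i                            ∎
  new : lookup (Z (α , a)) (fromℕ (suc n)) ≡ newEntry (Z α) a
  new = begin
    lookup (Z (α , a)) (fromℕ (suc n))        ≡⟨ lookup-Z (α , a) (fromℕ (suc n)) ⟩
    entry (α , a) (suc (toℕ (fromℕ (suc n)))) ≡⟨ cong (entry (α , a) ∘ suc) (toℕ-fromℕ (suc n)) ⟩
    entry (α , a) (suc (suc n))               ≡⟨ entry-new α a ⟩
    newEntry (Z α) a                          ∎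

Z-head : ∀ {n} (α : A (suc n)) → lookup (Z α) zero ≡ nothing
Z-head α = trans (lookup-Z α zero) (cong (λ r → restrictEntry r (get α 1)) (root-one α))

filled holes : ∀ {m} → Restr m → ℕ
filled = countᵇ is-just
holes  = countᵇ is-nothing

filled-∷ʳ : ∀ {m} (R : Restr m) e → filled (R ∷ʳ e) ≡ filled (e ∷ R)
filled-∷ʳ = count-∷ʳ (T? ∘ is-just)

holes-∷ʳ : ∀ {m} (R : Restr m) e → holes (R ∷ʳ e) ≡ holes (e ∷ R)
holes-∷ʳ = count-∷ʳ (T? ∘ is-nothing)

filled+holes : ∀ {m} (R : Restr m) → filled R + holes R ≡ m
filled+holes []            = refl
filled+holes (nothing ∷ R) = trans (+-suc (filled R) (holes R)) (cong suc (filled+holes R))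
filled+holes (just _ ∷ R)  = cong suc (filled+holes R)

pred-holes : ∀ {n} (R : Restr (suc n)) → pred (holes R) ≡ n ∸ filled R
pred-holes {n} R = begin
  pred (holes R)                       ≡⟨ cong pred (m+n∸m≡n (filled R) (holes R)) ⟨
  pred (filled R + holes R ∸ filled R) ≡⟨ cong (λ k → pred (k ∸ filled R)) (filled+holes R) ⟩
  pred (suc n ∸ filled R)              ≡⟨ pred[m∸n]≡m∸[1+n] (suc n) (filled R) ⟩
  n ∸ filled R                         ∎

holes-Z-positive : ∀ {n} (α : A (suc n)) → 1 ≤ holes (Z α)
holes-Z-positive α = head-hole (Z α) (Z-head α)
  where
  head-hole : ∀ {m} (R : Restr (suc m)) → lookup R zero ≡ nothing → 1 ≤ holes R
  head-hole (nothing ∷ R) refl = s≤s z≤n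

newEntry-just : ∀ {m} (R : Restr m) a {v} → newEntry R a ≡ just v → toℕ a ≡ v
newEntry-just R zero    refl = refl
newEntry-just R (suc i) eq with lookup R i | eq
... | just _  | refl = refl
... | nothing | ()

newEntry-is-just : ∀ {m} (R : Restr m) a → T (is-just (newEntry R a)) → newEntry R a ≡ just (toℕ a)
newEntry-is-just R a _ with newEntry R a in eq
... | just v = cong just (sym (newEntry-just R a eq))

newEntry-is-just-count : ∀ {m} (R : Restr m) →
                         HasCard (Fin (suc m)) (λ a → T (is-just (newEntry R a))) (suc (filled R))
newEntry-is-just-count R =
  HasCard-Fin-zero∈
    (HasCard-resp (λ i → subst T (sym (is-just-map _ (lookup R i))))
                  (λ i → subst T (is-just-map _ (lookup R i)))
                  (HasCard-lookup (T? ∘ is-just) R))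
    tt

newEntry≡nothing-count : ∀ {m} (R : Restr m) →
                         HasCard (Fin (suc m)) (λ a → newEntry R a ≡ nothing) (holes R)
newEntry≡nothing-count R =
  HasCard-Fin-zero∉
    (HasCard-resp (λ i → map≡nothing _ (lookup R i))
                  (λ i → map≡nothing⁻ _ (lookup R i))
                  (HasCard-lookup (T? ∘ is-nothing) R))
    λ ()

-- Counting restrictions

Image : ∀ {m} → Restr m → Set
Image {m} R = Σ (A m) λ α → Z α ≡ R

Images : ∀ {m} → ℕ → Restr m → Set
Images z R = Image R × filled R ≡ z

Image-extend : ∀ {n} {R : Restr (suc n)} a {e} → Image R → newEntry R a ≡ e → Image (R ∷ʳ e)
Image-extend a (α , refl) refl = (α , a) , Z-extend α a

ExtendedByHole : ∀ {n} → ℕ → Restr (suc (suc n)) → Set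
ExtendedByHole {n} z R′ = Σ (Restr (suc n)) λ R → Images z R × R ∷ʳ nothing ≡ R′

appendFilled : ∀ {n} → Restr (suc n) × Fin (suc (suc n)) → Restr (suc (suc n))
appendFilled (R , a) = R ∷ʳ just (toℕ a)

appendFilled-injective : ∀ {n} → Injective _≡_ _≡_ (appendFilled {n})
appendFilled-injective {x = R₁ , a₁} {R₂ , a₂} eq with ∷ʳ-injective R₁ R₂ eq
... | refl , just≡ = cong (R₁ ,_) (toℕ-injective (just-injective just≡))

ExtendedByFilled : ∀ {n} → ℕ → Restr (suc (suc n)) → Set
ExtendedByFilled {n} z R′ =
  Σ (Restr (suc n) × Fin (suc (suc n))) λ (R , a) →
    ((Image R × suc (filled R) ≡ z) × T (is-just (newEntry R a))) × appendFilled (R , a) ≡ R′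

extension⁺ : ∀ {n z} (R′ : Restr (suc (suc n))) →
             Images z R′ → ExtendedByHole z R′ ⊎ ExtendedByFilled z R′
extension⁺ R′ (((α , a) , refl) , refl) with newEntry (Z α) a in e
... | nothing = inj₁ (Z α , ((α , refl) , filled≡) , sym Z≡)
  where
  Z≡ : Z (α , a) ≡ Z α ∷ʳ nothing
  Z≡ = trans (Z-extend α a) (cong (Z α ∷ʳ_) e)
  filled≡ : filled (Z α) ≡ filled (Z (α , a))
  filled≡ = trans (sym (filled-∷ʳ (Z α) nothing)) (cong filled (sym Z≡))
... | just v = inj₂ ((Z α , a) , (((α , refl) , filled≡) , subst (T ∘ is-just) (sym e) tt) , sym Z≡)
  where
  Z≡ : Z (α , a) ≡ Z α ∷ʳ just (toℕ a)
  Z≡ = trans (Z-extend α a) (cong (Z α ∷ʳ_) (trans e (cong just (sym (newEntry-just (Z α) a e)))))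
  filled≡ : suc (filled (Z α)) ≡ filled (Z (α , a))
  filled≡ = trans (sym (filled-∷ʳ (Z α) (just (toℕ a)))) (cong filled (sym Z≡))

extension⁻ : ∀ {n z} (R′ : Restr (suc (suc n))) →
             ExtendedByHole z R′ ⊎ ExtendedByFilled z R′ → Images z R′
extension⁻ _ (inj₁ (R , (imR@(α , refl) , filled≡) , refl)) =
  Image-extend (suc zero) imR (cong (Maybe.map _) (Z-head α)) ,
  trans (filled-∷ʳ R nothing) filled≡
extension⁻ _ (inj₂ ((R , a) , ((imR , filled≡) , isJust) , refl)) =
  Image-extend a imR (newEntry-is-just R a isJust) ,
  trans (filled-∷ʳ R (just (toℕ a))) filled≡

hole≢filled : ∀ {n z} (R′ : Restr (suc (suc n))) → ExtendedByHole z R′ → ¬ ExtendedByFilled z R′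
hole≢filled _ (R₁ , _ , refl) ((R₂ , _) , _ , eq) with () ← ∷ʳ-injectiveʳ R₂ R₁ eq

extensions-by-hole : ∀ {n z c} → HasCard (Restr (suc n)) (Images z) c →
                     HasCard (Restr (suc (suc n))) (ExtendedByHole z) c
extensions-by-hole = HasCard-image (_∷ʳ nothing) (∷ʳ-injectiveˡ _ _)

extensions-by-filled : ∀ {n z c} → HasCard (Restr (suc n)) (Images z) c →
                       HasCard (Restr (suc (suc n))) (ExtendedByFilled (suc z)) (c * suc z)
extensions-by-filled images =
  HasCard-image appendFilled appendFilled-injective
    (HasCard-Σ (λ R (_ , filled≡) → subst (HasCard _ _) filled≡ (newEntry-is-just-count R))
               (HasCard-resp (λ _ (imR , filled≡) → imR , cong suc filled≡)
                             (λ _ (imR , filled≡) → imR , cong pred filled≡)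
                             images))

pascal-! : ∀ n z → (n C suc z) * suc z ! + (n C z) * z ! * suc z ≡ (suc n C suc z) * suc z !
pascal-! n z = begin
  (n C suc z) * suc z ! + (n C z) * z ! * suc z   ≡⟨ cong ((n C suc z) * suc z ! +_) z!*suc ⟩
  (n C suc z) * suc z ! + (n C z) * suc z !       ≡⟨ *-distribʳ-+ (suc z !) (n C suc z) (n C z) ⟨
  ((n C suc z) + (n C z)) * suc z !               ≡⟨ cong (_* suc z !) (+-comm (n C suc z) (n C z)) ⟩
  ((n C z) + (n C suc z)) * suc z !               ≡⟨ cong (_* suc z !) (nCk+nC[k+1]≡[n+1]C[k+1] n z) ⟩
  (suc n C suc z) * suc z !                       ∎
  where
  z!*suc : (n C z) * z ! * suc z ≡ (n C z) * suc z !
  z!*suc = trans (*-assoc (n C z) (z !) (suc z)) (cong ((n C z) *_) (*-comm (z !) (suc z)))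

images-count : ∀ n z → HasCard (Restr (suc n)) (Images z) ((n C z) * z !)
images-count zero zero =
  HasCard-resp (λ { _ refl → ((tt , zero) , refl) , refl })
               (λ { _ (((tt , zero) , refl) , _) → refl })
               (HasCard-singleton (nothing ∷ []))
images-count zero (suc z) = HasCard-empty λ { _ (((tt , zero) , refl) , ()) }
images-count (suc n) zero =
  HasCard-resp (λ R′ → extension⁻ R′ ∘ inj₁)
               (λ R′ imR′ → only-hole (extension⁺ R′ imR′))
               (extensions-by-hole (images-count n zero))
  where
  only-hole : ∀ {R′} → ExtendedByHole 0 R′ ⊎ ExtendedByFilled 0 R′ → ExtendedByHole 0 R′
  only-hole (inj₁ byHole) = byHole
  only-hole (inj₂ (_ , ((_ , ()) , _) , _))
images-count (suc n) (suc z) =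
  subst (HasCard _ _) (pascal-! n z)
    (HasCard-resp extension⁻ extension⁺
      (HasCard-⊎ hole≢filled (extensions-by-hole (images-count n (suc z)))
                             (extensions-by-filled (images-count n z))))

-- Counting tuples with a given restriction

Z-extend-≡ : ∀ {n} (α β : A (suc n)) a b →
             Z (α , a) ≡ Z (β , b) → Z α ≡ Z β × newEntry (Z β) a ≡ newEntry (Z β) b
Z-extend-≡ α β a b eq with ∷ʳ-injective (Z α) (Z β) (trans (sym (Z-extend α a)) (trans eq (Z-extend β b)))
... | Zα≡Zβ , last≡ = Zα≡Zβ , trans (cong (λ R → newEntry R a) (sym Zα≡Zβ)) last≡

Z-extend-≡⁻ : ∀ {n} (α β : A (suc n)) a b →
              Z α ≡ Z β → newEntry (Z β) a ≡ newEntry (Z β) b → Z (α , a) ≡ Z (β , b)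
Z-extend-≡⁻ α β a b Zα≡Zβ same = begin
  Z (α , a)                ≡⟨ Z-extend α a ⟩
  Z α ∷ʳ newEntry (Z α) a  ≡⟨ cong (λ R → R ∷ʳ newEntry R a) Zα≡Zβ ⟩
  Z β ∷ʳ newEntry (Z β) a  ≡⟨ cong (Z β ∷ʳ_) same ⟩
  Z β ∷ʳ newEntry (Z β) b  ≡⟨ Z-extend β b ⟨
  Z (β , b)                ∎

fibre-extend : ∀ {n c k} (β : A (suc n)) b →
               HasCard (A (suc n)) (λ α → Z α ≡ Z β) c →
               HasCard (Fin (suc (suc n))) (λ a → newEntry (Z β) a ≡ newEntry (Z β) b) k →
               HasCard (A (suc (suc n))) (λ α′ → Z α′ ≡ Z (β , b)) (c * k)
fibre-extend β b fibre sameEntry =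
  HasCard-resp (λ (α , a) (Zα≡Zβ , same) → Z-extend-≡⁻ α β a b Zα≡Zβ same)
               (λ (α , a) → Z-extend-≡ α β a b)
               (HasCard-Σ (λ _ _ → sameEntry) fibre)

pred[n]!*n≡n! : ∀ {n} → 1 ≤ n → pred n ! * n ≡ n !
pred[n]!*n≡n! {suc k} _ = *-comm (k !) (suc k)

fibre-count : ∀ {n} (β : A (suc n)) → HasCard (A (suc n)) (λ α → Z α ≡ Z β) (pred (holes (Z β)) !)
fibre-count {zero} (tt , zero) =
  HasCard-resp (λ { (tt , zero) _ → refl }) (λ { (tt , zero) _ → refl }) (HasCard-singleton (tt , zero))
fibre-count {suc n} (β , b) with newEntry (Z β) b in e
... | nothing =
  subst (HasCard _ _) count≡
    (fibre-extend β b (fibre-count β)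
      (HasCard-resp (λ _ x≡ → trans x≡ (sym e)) (λ _ x≡ → trans x≡ e)
                    (newEntry≡nothing-count (Z β))))
  where
  count≡ : pred (holes (Z β)) ! * holes (Z β) ≡ pred (holes (Z (β , b))) !
  count≡ = begin
    pred (holes (Z β)) ! * holes (Z β)    ≡⟨ pred[n]!*n≡n! (holes-Z-positive β) ⟩
    holes (Z β) !                         ≡⟨ cong (λ h → pred h !) (holes-∷ʳ (Z β) nothing) ⟨
    pred (holes (Z β ∷ʳ nothing)) !       ≡⟨ cong (λ R → pred (holes R) !)
                                                (trans (Z-extend β b) (cong (Z β ∷ʳ_) e)) ⟨
    pred (holes (Z (β , b))) !            ∎
... | just v =
  subst (HasCard _ _) count≡
    (fibre-extend β b (fibre-count β)
      (HasCard-resp (λ _ → cong (newEntry (Z β))) (λ a → toℕ-injective ∘ same-value a)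
                    (HasCard-singleton b)))
  where
  same-value : ∀ a → newEntry (Z β) a ≡ newEntry (Z β) b → toℕ a ≡ toℕ b
  same-value a same = trans (newEntry-just (Z β) a (trans same e)) (sym (newEntry-just (Z β) b e))
  count≡ : pred (holes (Z β)) ! * 1 ≡ pred (holes (Z (β , b))) !
  count≡ = begin
    pred (holes (Z β)) ! * 1              ≡⟨ *-identityʳ _ ⟩
    pred (holes (Z β)) !                  ≡⟨ cong (λ h → pred h !) (holes-∷ʳ (Z β) (just v)) ⟨
    pred (holes (Z β ∷ʳ just v)) !        ≡⟨ cong (λ R → pred (holes R) !)
                                                (trans (Z-extend β b) (cong (Z β ∷ʳ_) e)) ⟨
    pred (holes (Z (β , b))) !            ∎

is-just-restrictEntry : ∀ r v → is-just (restrictEntry r v) ≡ does (¬? (r ≟ 1))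
is-just-restrictEntry zero          v = refl
is-just-restrictEntry (suc zero)    v = refl
is-just-restrictEntry (suc (suc r)) v = refl

sizeN≡filled : ∀ {m} (α : A m) → sizeN α ≡ filled (Z α)
sizeN≡filled {m} α = begin
  length (filter N? (List.map suc (List.upTo m)))  ≡⟨ cong (length ∘ filter N?) (map-upTo suc m) ⟩
  length (filter N? (applyUpTo suc m))
    ≡⟨ count-tabulate≡length-filter (T? ∘ is-just) N? (entry α ∘ suc) suc
         (λ j → is-just-restrictEntry (root α (suc j)) _) m ⟨
  filled (tabulate {n = m} (entry α ∘ suc ∘ toℕ)) ≡⟨ cong filled (tabulate-cong (lookup-Z α)) ⟨
  filled (tabulate (lookup (Z α)))                 ≡⟨ cong filled (tabulate∘lookup (Z α)) ⟩
  filled (Z α)                                     ∎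
  where
  N? : Decidable λ j → ¬ root α j ≡ 1
  N? j = ¬? (root α j ≟ 1)

Images→sized : ∀ {m z} (R : Restr m) → Images z R → Σ (A m) λ α → Z α ≡ R × sizeN α ≡ z
Images→sized R ((α , refl) , refl) = α , refl , sizeN≡filled α

sized→Images : ∀ {m z} (R : Restr m) → (Σ (A m) λ α → Z α ≡ R × sizeN α ≡ z) → Images z R
sized→Images R (α , refl , refl) = (α , refl) , sym (sizeN≡filled α)

proposition4p1 : (m : ℕ) → 1 ≤ m →
    ((z : ℕ) → z ≤ m ∸ 1 →
       HasCard (Restr m) (λ R → Σ (A m) λ α → Z α ≡ R × sizeN α ≡ z)
               (((m ∸ 1) C z) * (z !)))
  × ((z : ℕ) (R : Restr m) → (Σ (A m) λ α → Z α ≡ R × sizeN α ≡ z) →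
       HasCard (A m) (λ α → Z α ≡ R) ((m ∸ 1 ∸ z) !))
proposition4p1 (suc n) _ =
  (λ z _ → HasCard-resp Images→sized sized→Images (images-count n z)) ,
  λ { _ _ (β , refl , refl) → subst (HasCard _ _) (cong _! (pred-holes-Z β)) (fibre-count β) }
  where
  pred-holes-Z : ∀ (β : A (suc n)) → pred (holes (Z β)) ≡ n ∸ sizeN β
  pred-holes-Z β = trans (pred-holes (Z β)) (cong (n ∸_) (sym (sizeN≡filled β)))
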